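{- Let $\Pi$ be a ground program with set of atoms $\mathcal{A}$, and let $A \subseteq \mathcal{A}$. For every answer set $I \in AS(\Pi)$ it holds that $I|_{\overline{A}} \in AS(\mathit{omit}(\Pi,A))$.
   Context: A ground program $\Pi$ is a finite set of rules $r$ of the form $\alpha_0 \leftarrow \alpha_1,\dots,\alpha_m, \mathit{not}\ \alpha_{m+1},\dots,\mathit{not}\ \alpha_n$ ($0\le m\le n$), where $\alpha_1,\dots,\alpha_n$ are propositional atoms and $\alpha_0$ is an atom or $\bot$ (then $r$ is a constraint); programs may also contain choice rules $\{\alpha\}\leftarrow B$. Write $H(r)=\alpha_0$, $B^+(r)=\{\alpha_1,\dots,\alpha_m\}$, $B^-(r)=\{\alpha_{m+1},\dots,\alpha_n\}$, $B^\pm(r)=B^+(r)\cup B^-(r)$, and $B(r)$ for the body. $\mathcal{A}$ is the set of atoms of $\Pi$. An interpretation $I$ (a set of atoms) satisfies $B(r)$ if $B^+(r)\subseteq I$ and $B^-(r)\cap I=\emptyset$. $I$ is an answer set of $\Pi$ iff $I$ is a $\subseteq$-minimal model of $\{r\in\Pi \mid I\models B(r)\}$; $AS(\Pi)$ denotes the set of answer sets. A choice rule $\{\alpha\}\leftarrow B$ abbreviates the rules $\alpha\leftarrow B,\mathit{not}\ \bar\alpha$ and $\bar\alpha \leftarrow B, \mathit{not}\ \alpha$ with a fresh auxiliary atom $\bar\alpha$; answer sets are considered with these auxiliary atoms projected away. For $A\subseteq\mathcal{A}$ and a rule $r$, $\mathit{omit}(r,A)$ is: (a) $r$ itself if $A\cap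 B^\pm(r)=\emptyset$ and $H(r)\notin A$; (b) the choice rule $\{H(r)\}\leftarrow B^+(r)\setminus A, \mathit{not}\ (B^-(r)\setminus A)$ if $A\cap B^\pm(r)\neq\emptyset$ and $H(r)\notin A\cup\{\bot\}$; (c) no rule otherwise. For a choice rule $\{\alpha\}\leftarrow B$, it is kept if no body atom is in $A$ and $\alpha\notin A$, becomes $\{\alpha\}\leftarrow B\setminus A$ (omitted atoms and their literals removed from the body) if some body atom is in $A$ and $\alpha\notin A$, and is dropped otherwise. $\mathit{omit}(\Pi,A)=\bigcup_{r\in\Pi}\mathit{omit}(r,A)$. Let $\overline{A}=\mathcal{A}\setminus A$ and $I|_{\overline{A}}=I\cap\overline{A}$. -}

module Defs where

open import Data.Nat using (ℕ; _≟_)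
open import Data.Bool using (Bool; true; false; if_then_else_; _∨_; _∧_; not)
open import Data.List using (List; []; _∷_; map; filter; _++_; concatMap)
open import Data.Bool.ListAction using (any)
open import Relation.Binary.PropositionalEquality using (_≡_)
open import Data.List.Relation.Unary.All using (All)
open import Data.List.Membership.Propositional using (_∈_)
open import Data.Maybe using (Maybe; just; nothing)
open import Data.Sum using (_⊎_; inj₁; inj₂)
open import Data.Product using (_×_; Σ)
open import Data.Empty using (⊥)
open import Relation.Nullary using (¬_; Dec; yes; no)
open import Relation.Nullary.Decidable using (⌊_⌋)
open import Relation.Unary using (∁)
open import Data.List.Membership.DecPropositional _≟_ using (_∈?_)

Atom : Set
Atom = ℕ

-- Head of a normal rule: an atom or ⊥ (constraint).
data Head : Set where
  atom : Atom → Head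
  bot  : Head

-- A ground rule: normal rule  H ← B⁺, not B⁻   or choice rule  {α} ← B⁺, not B⁻.
data Rule : Set where
  normal : Head → List Atom → List Atom → Rule
  choice : Atom → List Atom → List Atom → Rule

Program : Set
Program = List Rule

record NRule (X : Set) : Set where
  constructor nrule
  field
    hd  : Maybe X     -- nothing = ⊥
    pos : List X
    neg : List X
open NRule public

Interp : Set → Set
Interp X = X → Bool

_∈ᵢ_ : {X : Set} → X → Interp X → Set
a ∈ᵢ I = I a ≡ true

_⊆ᵢ_ : {X : Set} → Interp X → Interp X → Set
I ⊆ᵢ J = ∀ a → a ∈ᵢ I → a ∈ᵢ J

BodySat : {X : Set} → Interp X → NRule X → Set
BodySat I r = All (_∈ᵢ I) (pos r) × All (λ a → ¬ (a ∈ᵢ I)) (neg r)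

HeadSat : {X : Set} → Interp X → Maybe X → Set
HeadSat I (just a) = a ∈ᵢ I
HeadSat I nothing  = ⊥

Sat : {X : Set} → Interp X → NRule X → Set
Sat J r = BodySat J r → HeadSat J (hd r)

-- J is a model of the reduct {r ∈ P | I ⊨ B(r)}
ModelOfReduct : {X : Set} → List (NRule X) → Interp X → Interp X → Set
ModelOfReduct P I J = ∀ r → r ∈ P → BodySat I r → Sat J r

IsAnswerSetN : {X : Set} → List (NRule X) → Interp X → Set
IsAnswerSetN P I =
  ModelOfReduct P I I ×
  (∀ (J : Interp _) → J ⊆ᵢ I → ModelOfReduct P I J → I ⊆ᵢ J)

-- Choice rules are abbreviations using fresh auxiliary atoms ᾱ = inj₂ α.

Ext : Set
Ext = Atom ⊎ Atom

translateRule : Rule → List (NRule Ext)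
translateRule (normal (atom h) p n) = nrule (just (inj₁ h)) (map inj₁ p) (map inj₁ n) ∷ []
translateRule (normal bot p n)      = nrule nothing (map inj₁ p) (map inj₁ n) ∷ []
translateRule (choice α p n) =
  nrule (just (inj₁ α)) (map inj₁ p) (inj₂ α ∷ map inj₁ n) ∷
  nrule (just (inj₂ α)) (map inj₁ p) (inj₁ α ∷ map inj₁ n) ∷ []

translate : Program → List (NRule Ext)
translate = concatMap translateRule

-- I ∈ AS(Π): I is the projection (onto original atoms) of an answer set
-- of the translated normal program.
IsAnswerSet : Program → Interp Atom → Set
IsAnswerSet Π I =
  Σ (Interp Ext) λ J → IsAnswerSetN (translate Π) J ×
    (∀ a → I a ≡ J (inj₁ a))

ruleAtoms : Rule → List Atom
ruleAtoms (normal (atom h) p n) = h ∷ p ++ n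
ruleAtoms (normal bot p n)      = p ++ n
ruleAtoms (choice α p n)        = α ∷ p ++ n

atoms : Program → List Atom
atoms = concatMap ruleAtoms

inA : List Atom → Atom → Bool
inA A a = ⌊ a ∈? A ⌋

meets : List Atom → List Atom → Bool
meets A xs = any (inA A) xs

strip : List Atom → List Atom → List Atom
strip A xs = filter (λ a → ¬? (a ∈? A)) xs
  where open import Relation.Nullary.Decidable using (¬?)

omitRule : List Atom → Rule → List Rule
omitRule A (normal (atom h) p n) =
  if inA A h then []
  else (if meets A (p ++ n)
        then choice h (strip A p) (strip A n) ∷ []
        else normal (atom h) p n ∷ [])
omitRule A (normal bot p n) =
  if meets A (p ++ n) then []
  else normal bot p n ∷ []
omitRule A (choice α p n) =
  if inA A α then []
  else (if meets A (p ++ n)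
        then choice α (strip A p) (strip A n) ∷ []
        else choice α p n ∷ [])

omit : Program → List Atom → Program
omit Π A = concatMap (omitRule A) Π

restrict : Program → List Atom → Interp Atom → Interp Atom
restrict Π A I a = I a ∧ inA (atoms Π) a ∧ not (inA A a)

module Submission where

-- Let J be an answer set of the normal program translate Π whose projection
-- is I, and let I' = I|Ā.  As answer set of translate (omit Π A) we take the
-- choice completion J' of I': it agrees with I' on original atoms and makes
-- the auxiliary atom ᾱ true exactly when α ∉ I' and some choice rule for α
-- fires under I'.  The proof has three parts.
--   * Choice completion (module ChoiceCompletion): for any program Q and
--     interpretation M, the completion satisfies all translated choice rules
--     of Q, and every reduct model containing M contains its auxiliary atoms.
--   * Shape of omit (module OmitShape): a normal rule of omit Π A is a rule of
--     Π avoiding A; a rule of Π whose head h ∉ A leaves behind a rule for h on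
--     a body pruned to atoms outside A.
--   * The theorem (module OmitPreservesAnswerSets): J' is a model of its
--     reduct, since kept normal rules are evaluated by J' as by J; and it is
--     minimal, since any smaller reduct model K patched with J on omitted and
--     auxiliary atoms is a reduct model of translate Π below J, so equals J.

open import Defs
open import Data.List using (List; []; _∷_; map; _++_; concatMap)
open import Data.List.Relation.Binary.Subset.Propositional using (_⊆_)
open import Data.Bool using (true; false; if_then_else_)
open import Data.Bool.Properties using (_≟_; ∧-identityʳ)
open import Data.Sum using (inj₁; inj₂)
open import Data.Product using (_×_; _,_; ∃; proj₁; proj₂)
open import Data.Empty using (⊥)
open import Function using (_∘_)
open import Relation.Nullary using (¬_; Dec; yes; no)
open import Relation.Nullary.Decidable using (⌊_⌋; ¬?; _×-dec_; isYes≗does; dec-true; dec-false; decidable-stable)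
open import Relation.Binary.PropositionalEquality using (_≡_; refl; sym; trans; cong)
open import Data.List.Relation.Unary.All as All using (All; []; _∷_)
open import Data.List.Relation.Unary.All.Properties using (map⁺; map⁻; ++⁻)
open import Data.List.Relation.Unary.Any using (Any; any?; here; there)
open import Data.List.Membership.Propositional using (_∈_; _∉_; find; lose)
open import Data.List.Membership.Propositional.Properties using (∈-concatMap⁺; ∈-concatMap⁻; ∈-filter⁻; ∈-++⁺ˡ; ∈-++⁺ʳ)
open import Data.Nat using () renaming (_≟_ to _≟ℕ_)
open import Data.List.Membership.DecPropositional _≟ℕ_ using (_∈?_)

isYes-sound : ∀ {p} {P : Set p} (d : Dec P) → ⌊ d ⌋ ≡ true → P
isYes-sound (yes p) _ = p
isYes-sound (no _) ()

isYes-complete : ∀ {p} {P : Set p} (d : Dec P) → P → ⌊ d ⌋ ≡ true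
isYes-complete d p = trans (isYes≗does d) (dec-true d p)

isYes-refute : ∀ {p} {P : Set p} (d : Dec P) → ¬ P → ⌊ d ⌋ ≡ false
isYes-refute d ¬p = trans (isYes≗does d) (dec-false d ¬p)

concatMap-∈ : {X Y : Set} (f : X → List Y) {xs : List X} {x : X} {y : Y} →
  x ∈ xs → y ∈ f x → y ∈ concatMap f xs
concatMap-∈ f x∈ y∈ = ∈-concatMap⁺ f (lose x∈ y∈)

concatMap-∈⁻ : {X Y : Set} (f : X → List Y) (xs : List X) {y : Y} →
  y ∈ concatMap f xs → ∃ λ x → x ∈ xs × y ∈ f x
concatMap-∈⁻ f xs y∈ = find (∈-concatMap⁻ f {xs = xs} y∈)

infix 4 _⊆[_]_
_⊆[_]_ : {X : Set} → List X → (X → Set) → List X → Set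
ys ⊆[ G ] xs = ∀ {a} → a ∈ ys → a ∈ xs × G a

⊆[]-self : {X : Set} {G : X → Set} {xs : List X} → All G xs → xs ⊆[ G ] xs
⊆[]-self gs a∈ = a∈ , All.lookup gs a∈

⊆[]-weaken : {X : Set} {G H : X → Set} {xs ys : List X} →
  (∀ {a} → a ∈ xs → G a → H a) → ys ⊆[ G ] xs → ys ⊆[ H ] xs
⊆[]-weaken f s a∈ = let (a∈xs , g) = s a∈ in a∈xs , f a∈xs g

Body : {X : Set} → Interp X → List X → List X → Set
Body M p n = All (_∈ᵢ M) p × All (λ a → ¬ a ∈ᵢ M) n

body-transfer : {X : Set} {M N : Interp X} {p n p' n' : List X} →
  p' ⊆[ (λ a → M a ≡ N a) ] p → n' ⊆[ (λ a → M a ≡ N a) ] n →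
  Body M p n → Body N p' n'
body-transfer sp sn (pos , neg) =
  All.tabulate (λ a∈ → let (a∈p , eq) = sp a∈ in trans (sym eq) (All.lookup pos a∈p)) ,
  All.tabulate (λ a∈ Na → let (a∈n , eq) = sn a∈ in All.lookup neg a∈n (trans eq Na))

body-map⁺ : {M : Interp Ext} {p n : List Atom} →
  Body (M ∘ inj₁) p n → Body M (map inj₁ p) (map inj₁ n)
body-map⁺ (pos , neg) = map⁺ pos , map⁺ neg

body-map⁻ : {M : Interp Ext} {p n : List Atom} →
  Body M (map inj₁ p) (map inj₁ n) → Body (M ∘ inj₁) p n
body-map⁻ (pos , neg) = map⁻ pos , map⁻ neg

drop-aux : {M : Interp Ext} {p n : List Atom} {x : Ext} →
  Body M (map inj₁ p) (x ∷ map inj₁ n) → Body (M ∘ inj₁) p n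
drop-aux (pos , _ ∷ neg) = map⁻ pos , map⁻ neg

translate-∈ : {Q : Program} {r₀ : Rule} {r : NRule Ext} →
  r₀ ∈ Q → r ∈ translateRule r₀ → r ∈ translate Q
translate-∈ = concatMap-∈ translateRule

module ChoiceCompletion (Q : Program) (M : Interp Atom) where

  ChoiceFor : Atom → Rule → Set
  ChoiceFor a (choice b p n) = b ≡ a × Body M p n
  ChoiceFor a (normal _ _ _) = ⊥

  choiceFor? : ∀ a r → Dec (ChoiceFor a r)
  choiceFor? a (choice b p n) =
    (b ≟ℕ a) ×-dec (All.all? (λ x → M x ≟ true) p ×-dec All.all? (λ x → ¬? (M x ≟ true)) n)
  choiceFor? a (normal _ _ _) = no λ ()

  Aux : Atom → Set
  Aux a = ¬ a ∈ᵢ M × Any (ChoiceFor a) Q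

  aux? : ∀ a → Dec (Aux a)
  aux? a = ¬? (M a ≟ true) ×-dec any? (choiceFor? a) Q

  complete : Interp Ext
  complete (inj₁ a) = M a
  complete (inj₂ a) = ⌊ aux? a ⌋

  complete-aux-false : ∀ {a} → a ∈ᵢ M → ¬ complete (inj₂ a) ≡ true
  complete-aux-false {a} Ma e = proj₁ (isYes-sound (aux? a) e) Ma

  -- The completion satisfies both translated rules of every choice rule of Q:
  -- α ← B, not ᾱ  holds since ᾱ false and B true would make ᾱ true, and
  -- ᾱ ← B, not α  holds by the definition of ᾱ.
  complete-choice-sat : ∀ {h p n r} → choice h p n ∈ Q → r ∈ translateRule (choice h p n) →
    Sat complete r
  complete-choice-sat {h} c∈ (here refl) (pos , ¬aux ∷ neg) =
    decidable-stable (M h ≟ true) λ ¬Mh →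
      ¬aux (isYes-complete (aux? h) (¬Mh , lose c∈ (refl , map⁻ pos , map⁻ neg)))
  complete-choice-sat {h} c∈ (there (here refl)) (pos , ¬Mh ∷ neg) =
    isYes-complete (aux? h) (¬Mh , lose c∈ (refl , map⁻ pos , map⁻ neg))

  complete-aux-least : ∀ {K a} → K ⊆ᵢ complete → ModelOfReduct (translate Q) complete K →
    (∀ {b} → b ∈ᵢ M → inj₁ b ∈ᵢ K) → complete (inj₂ a) ≡ true → K (inj₂ a) ≡ true
  complete-aux-least {K} {a} K⊆ K-model M⊆K e with isYes-sound (aux? a) e
  ... | ¬Ma , fires with find fires
  ...   | normal _ _ _ , _ , ()
  ...   | choice _ p n , c∈ , refl , pos , neg =
    K-model _ (translate-∈ c∈ (there (here refl)))
      (map⁺ pos , ¬Ma ∷ map⁺ neg)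
      (map⁺ (All.map M⊆K pos) ,
       (¬Ma ∘ K⊆ (inj₁ a)) ∷ map⁺ (All.map (λ ¬Mb Kb → ¬Mb (K⊆ (inj₁ _) Kb)) neg))

module OmitShape (A : List Atom) where

  avoids : ∀ xs → meets A xs ≡ false → All (_∉ A) xs
  avoids [] _ = []
  avoids (x ∷ xs) e with x ∈? A
  avoids (x ∷ xs) () | yes _
  ... | no x∉A = x∉A ∷ avoids xs e

  omit-normal : ∀ {r₀ x p n} → normal x p n ∈ omitRule A r₀ →
    r₀ ≡ normal x p n × All (_∉ A) (ruleAtoms r₀)
  omit-normal {normal (atom h) p n} r∈ with h ∈? A | meets A (p ++ n) in em
  omit-normal {normal (atom h) p n} () | yes _ | _
  omit-normal {normal (atom h) p n} (here ()) | no _ | true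
  omit-normal {normal (atom h) p n} (there ()) | no _ | true
  omit-normal {normal (atom h) p n} (here refl) | no h∉A | false = refl , h∉A ∷ avoids (p ++ n) em
  omit-normal {normal (atom h) p n} (there ()) | no _ | false
  omit-normal {normal bot p n} r∈ with meets A (p ++ n) in em
  omit-normal {normal bot p n} () | true
  omit-normal {normal bot p n} (here refl) | false = refl , avoids (p ++ n) em
  omit-normal {normal bot p n} (there ()) | false
  omit-normal {choice α p n} r∈ with inA A α | meets A (p ++ n)
  omit-normal {choice α p n} () | true | _
  omit-normal {choice α p n} (here ()) | false | true
  omit-normal {choice α p n} (there ()) | false | true
  omit-normal {choice α p n} (here ()) | false | false
  omit-normal {choice α p n} (there ()) | false | false

  data Defines (h : Atom) (p n : List Atom) : Rule → Set where
    normal-rule : Defines h p n (normal (atom h) p n)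
    choice-rule : Defines h p n (choice h p n)

  data Remnant (h : Atom) (p n : List Atom) : Rule → Set where
    unchanged : p ⊆[ _∉ A ] p → n ⊆[ _∉ A ] n → Remnant h p n (normal (atom h) p n)
    relaxed   : ∀ {p' n'} → p' ⊆[ _∉ A ] p → n' ⊆[ _∉ A ] n → Remnant h p n (choice h p' n')

  survivor : ∀ {h p n r₀} → Defines h p n r₀ → h ∉ A →
    ∃ λ r₁ → r₁ ∈ omitRule A r₀ × Remnant h p n r₁
  survivor {h} {p} {n} normal-rule h∉A rewrite isYes-refute (h ∈? A) h∉A
    with meets A (p ++ n) in em
  ... | true  = _ , here refl , relaxed (∈-filter⁻ _) (∈-filter⁻ _)
  ... | false = _ , here refl , unchanged (⊆[]-self (proj₁ av)) (⊆[]-self (proj₂ av))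
    where av = ++⁻ p (avoids (p ++ n) em)
  survivor {h} {p} {n} choice-rule h∉A rewrite isYes-refute (h ∈? A) h∉A
    with meets A (p ++ n) in em
  ... | true  = _ , here refl , relaxed (∈-filter⁻ _) (∈-filter⁻ _)
  ... | false = _ , here refl , relaxed (⊆[]-self (proj₁ av)) (⊆[]-self (proj₂ av))
    where av = ++⁻ p (avoids (p ++ n) em)

restrict-true : ∀ {Π A I a} → restrict Π A I a ≡ true → I a ≡ true × a ∉ A
restrict-true {Π} {A} {I} {a} e with I a | a ∈? atoms Π | a ∈? A
... | true  | yes _ | no a∉A = refl , a∉A
restrict-true () | true | yes _ | yes _
restrict-true () | true | no _ | _
restrict-true () | false | _ | _

restrict-agrees : ∀ {Π A I a} → a ∈ atoms Π → a ∉ A → restrict Π A I a ≡ I a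
restrict-agrees {Π} {A} {I} {a} a∈Π a∉A
  rewrite isYes-complete (a ∈? atoms Π) a∈Π | isYes-refute (a ∈? A) a∉A = ∧-identityʳ (I a)

module OmitPreservesAnswerSets
  (Π : Program) (A : List Atom) (I : Interp Atom) (J : Interp Ext)
  (J-model : ModelOfReduct (translate Π) J J)
  (J-minimal : ∀ K → K ⊆ᵢ J → ModelOfReduct (translate Π) J K → J ⊆ᵢ K)
  (I≡J : ∀ a → I a ≡ J (inj₁ a)) where

  Π' : Program
  Π' = omit Π A

  I' : Interp Atom
  I' = restrict Π A I

  open ChoiceCompletion Π' I'
  open OmitShape A

  J' : Interp Ext
  J' = complete

  J-fires : ∀ {r} → r ∈ translate Π → BodySat J r → HeadSat J (hd r)
  J-fires r∈ b = J-model _ r∈ b b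

  Good : Atom → Set
  Good a = a ∈ atoms Π × a ∉ A

  I'-agrees : ∀ {a} → Good a → I' a ≡ J (inj₁ a)
  I'-agrees {a} (a∈Π , a∉A) = trans (restrict-agrees {Π} {A} {I} a∈Π a∉A) (I≡J a)

  I'⊆J : ∀ {a} → I' a ≡ true → J (inj₁ a) ≡ true
  I'⊆J {a} e = trans (sym (I≡J a)) (proj₁ (restrict-true {Π} {A} {I} e))

  J-to-J' : ∀ {p n p' n'} → (∀ {a} → a ∈ p ++ n → a ∈ atoms Π) →
    p' ⊆[ _∉ A ] p → n' ⊆[ _∉ A ] n → Body (J ∘ inj₁) p n → Body (J' ∘ inj₁) p' n'
  J-to-J' {p} inΠ sp sn = body-transfer
    (⊆[]-weaken (λ a∈ a∉A → sym (I'-agrees (inΠ (∈-++⁺ˡ a∈) , a∉A))) sp)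
    (⊆[]-weaken (λ a∈ a∉A → sym (I'-agrees (inΠ (∈-++⁺ʳ p a∈) , a∉A))) sn)

  J'-to-J : ∀ {p n} → (∀ {a} → a ∈ p ++ n → Good a) →
    Body (J' ∘ inj₁) p n → Body (J ∘ inj₁) p n
  J'-to-J {p} good = body-transfer
    (λ a∈ → a∈ , I'-agrees (good (∈-++⁺ˡ a∈)))
    (λ a∈ → a∈ , I'-agrees (good (∈-++⁺ʳ p a∈)))

  -- Kept normal rules of Π' hold in J' because they hold in J.
  kept-sat : ∀ {r₀ x p n r} → r₀ ∈ Π → normal x p n ∈ omitRule A r₀ →
    r ∈ translateRule (normal x p n) → Sat J' r
  kept-sat {r₀} r₀∈ r₁∈ r∈ with omit-normal {r₀} r₁∈
  kept-sat {x = atom h} {p} {n} r₀∈ _ (here refl) | refl , avoid = λ b →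
    trans (I'-agrees (good (here refl)))
      (J-fires (translate-∈ r₀∈ (here refl)) (body-map⁺ (J'-to-J {p} {n} (good ∘ there) (body-map⁻ b))))
    where
      good : ∀ {a} → a ∈ ruleAtoms (normal (atom h) p n) → Good a
      good a∈ = concatMap-∈ ruleAtoms r₀∈ a∈ , All.lookup avoid a∈
  kept-sat {x = bot} {p} {n} r₀∈ _ (here refl) | refl , avoid = λ b →
    J-fires (translate-∈ r₀∈ (here refl)) (body-map⁺ (J'-to-J {p} {n} good (body-map⁻ b)))
    where
      good : ∀ {a} → a ∈ ruleAtoms (normal bot p n) → Good a
      good a∈ = concatMap-∈ ruleAtoms r₀∈ a∈ , All.lookup avoid a∈

  J'-model : ModelOfReduct (translate Π') J' J'
  J'-model r r∈ _ with concatMap-∈⁻ translateRule Π' r∈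
  ... | choice h p n , r₁∈ , r∈r₁ = complete-choice-sat r₁∈ r∈r₁
  ... | normal x p n , r₁∈ , r∈r₁ with concatMap-∈⁻ (omitRule A) Π r₁∈
  ...   | r₀ , r₀∈ , r₁∈r₀ = kept-sat r₀∈ r₁∈r₀ r∈r₁

  defines-atoms : ∀ {r₀ h p n a} → r₀ ∈ Π → Defines h p n r₀ → a ∈ h ∷ p ++ n → a ∈ atoms Π
  defines-atoms r₀∈ normal-rule = concatMap-∈ ruleAtoms r₀∈
  defines-atoms r₀∈ choice-rule = concatMap-∈ ruleAtoms r₀∈

  module Minimality (K : Interp Ext) (K⊆J' : K ⊆ᵢ J')
    (K-model : ModelOfReduct (translate Π') J' K) where

    K* : Interp Ext
    K* (inj₁ a) = if inA A a then J (inj₁ a) else K (inj₁ a)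
    K* (inj₂ a) = J (inj₂ a)

    K*-agrees : ∀ {a} → a ∉ A → K* (inj₁ a) ≡ K (inj₁ a)
    K*-agrees {a} a∉A = cong (λ b → if b then J (inj₁ a) else K (inj₁ a)) (isYes-refute (a ∈? A) a∉A)

    K*⊆J : K* ⊆ᵢ J
    K*⊆J (inj₁ a) e with a ∈? A
    ... | yes _ = e
    ... | no _  = I'⊆J (K⊆J' (inj₁ a) e)
    K*⊆J (inj₂ a) e = e

    K*-to-K : ∀ {p n p' n'} → p' ⊆[ _∉ A ] p → n' ⊆[ _∉ A ] n →
      Body (K* ∘ inj₁) p n → Body (K ∘ inj₁) p' n'
    K*-to-K sp sn = body-transfer (⊆[]-weaken (λ _ → K*-agrees) sp) (⊆[]-weaken (λ _ → K*-agrees) sn)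

    remnant-forces : ∀ {h p n r₁} → r₁ ∈ Π' → Remnant h p n r₁ →
      (∀ {a} → a ∈ h ∷ p ++ n → a ∈ atoms Π) → h ∉ A → J (inj₁ h) ≡ true →
      Body (J ∘ inj₁) p n → Body (K* ∘ inj₁) p n → K (inj₁ h) ≡ true
    remnant-forces r₁∈ (unchanged sp sn) inΠ _ _ bJ bK =
      K-model _ (translate-∈ r₁∈ (here refl))
        (body-map⁺ (J-to-J' (inΠ ∘ there) sp sn bJ)) (body-map⁺ (K*-to-K sp sn bK))
    remnant-forces {h} r₁∈ (relaxed sp sn) inΠ h∉A Jh bJ bK =
      K-model _ (translate-∈ r₁∈ (here refl))
        (map⁺ (proj₁ bJ') , aux∉J' ∷ map⁺ (proj₂ bJ'))
        (map⁺ (proj₁ bK') , (aux∉J' ∘ K⊆J' (inj₂ h)) ∷ map⁺ (proj₂ bK'))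
      where
        bJ' = J-to-J' (inΠ ∘ there) sp sn bJ
        bK' = K*-to-K sp sn bK
        aux∉J' : ¬ J' (inj₂ h) ≡ true
        aux∉J' = complete-aux-false (trans (I'-agrees (inΠ (here refl) , h∉A)) Jh)

    derived-head : ∀ {r₀ h p n} → r₀ ∈ Π → Defines h p n r₀ → J (inj₁ h) ≡ true →
      Body (J ∘ inj₁) p n → Body (K* ∘ inj₁) p n → K* (inj₁ h) ≡ true
    derived-head {h = h} r₀∈ d Jh bJ bK with h ∈? A
    ... | yes _ = Jh
    ... | no h∉A with survivor d h∉A
    ...   | _ , r₁∈ , remnant =
      remnant-forces (concatMap-∈ (omitRule A) r₀∈ r₁∈) remnant (defines-atoms r₀∈ d) h∉A Jh bJ bK

    K*-model : ModelOfReduct (translate Π) J K*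
    K*-model r r∈ bJ bK with concatMap-∈⁻ translateRule Π r∈
    ... | normal (atom h) p n , r₀∈ , here refl =
      derived-head r₀∈ normal-rule (J-fires r∈ bJ) (body-map⁻ bJ) (body-map⁻ bK)
    ... | normal bot p n , r₀∈ , here refl = J-fires r∈ bJ
    ... | choice h p n , r₀∈ , here refl =
      derived-head r₀∈ choice-rule (J-fires r∈ bJ) (drop-aux bJ) (drop-aux bK)
    ... | choice h p n , r₀∈ , there (here refl) = J-fires r∈ bJ

    -- By minimality of J, K* = J; hence K contains all of J'.
    I'⊆K : ∀ {a} → I' a ≡ true → K (inj₁ a) ≡ true
    I'⊆K {a} e = trans (sym (K*-agrees (proj₂ (restrict-true {Π} {A} {I} e))))
      (J-minimal K* K*⊆J K*-model (inj₁ a) (I'⊆J e))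

    J'⊆K : J' ⊆ᵢ K
    J'⊆K (inj₁ a) e = I'⊆K e
    J'⊆K (inj₂ a) e = complete-aux-least K⊆J' K-model I'⊆K e

  result : IsAnswerSet Π' I'
  result = J' , (J'-model , λ K K⊆J' K-model → Minimality.J'⊆K K K⊆J' K-model) , λ _ → refl

theorem1 : (Π : Program) (A : List Atom) → A ⊆ atoms Π →
    (I : Interp Atom) → IsAnswerSet Π I → IsAnswerSet (omit Π A) (restrict Π A I)
theorem1 Π A _ I (J , (J-model , J-minimal) , I≡J) =
  OmitPreservesAnswerSets.result Π A I J J-model J-minimal I≡J
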